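{- Let $C_3\in\mathbb{N}_{\ge1}$, $D\in\mathbb{Z}\setminus\{0\}$ with $\gcd(C_3,D)=1$, and fix $q\in\mathbb{N}_{\ge1}$. For every $(a,b)\in\mathbb{N}^2$ with $\gcd(a,b)=1$ and $(u,v)\in\mathbb{Z}^2$ with $\gcd(u,v)=1$ satisfying $\min(u^2,v^2)>-D/C_3$ and $au^2-bv^2=\frac{b-a}{C_3}D$, the condition $u+v\mid q\,k(u,v)$, where $k(u,v)=\gcd(C_3u^2+D,C_3v^2+D)$, is equivalent to $\frac{c_3}{C_3}\mid q$, where $c_3=\frac{b-a}{\gcd(u-v,b-a)}$; equivalently, to $\frac{b-a}{C_3q}\mid\gcd(u-v,b-a)$. -}

module Defs where

open import Data.Nat.Base as ℕ using (ℕ)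
open import Data.Integer.Base using (ℤ; +_; _+_; _-_; _*_; _/_; NonZero)
open import Data.Integer.GCD using (gcd)

kfun : ℕ → ℤ → ℤ → ℤ → ℤ
kfun C₃ D u v = gcd (+ C₃ * (u * u) + D) (+ C₃ * (v * v) + D)

gfun : ℕ → ℕ → ℤ → ℤ → ℤ
gfun a b u v = gcd (u - v) (+ b - + a)

c3fun : (a b : ℕ) (u v : ℤ) → .{{NonZero (gfun a b u v)}} → ℤ
c3fun a b u v = (+ b - + a) / gfun a b u v

-- Clearing denominators, a (C₃u² + D) = b (C₃v² + D) with both values positive, so
-- coprimality of a and b gives C₃u² + D = b k and C₃v² + D = a k for k = k(u,v).
-- Subtracting, C₃ (u - v)(u + v) = (b - a) k.  Cancelling k and C₃(u - v), u + v ∣ q k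
-- becomes b - a ∣ (u - v) C₃ q, and since b - a always divides (b - a) C₃ q this is
-- b - a ∣ g C₃ q with g = gcd(u - v, b - a), i.e. c₃ ∣ C₃ q.
module Submission where

open import Defs
open import Data.Nat.Base as ℕ using (ℕ)
open import Data.Nat.GCD as ℕG using ()
open import Data.Integer.Base as ℤ using (ℤ; +_; _+_; _-_; _*_; _⊓_; -_; NonZero; 0ℤ; 1ℤ)
open import Data.Integer.Divisibility using (_∣_)
open import Data.Integer.GCD using (gcd)
open import Data.Rational.Base as ℚ using (ℚ)
open import Function.Bundles using (_⇔_)
open import Data.Product.Base using (_×_)
open import Relation.Binary.PropositionalEquality using (_≡_; _≢_)

open import Data.Nat.Base using (suc)
open import Data.Integer.Base using (_<_; _≤_; _/_; _%_; +≤+)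
open import Data.Integer.Divisibility using (*-monoʳ-∣; *-monoˡ-∣; *-cancelˡ-∣; *-cancelʳ-∣)
open import Data.Integer.GCD using (gcd[i,j]∣j; gcd[i,j]≡0⇒i≡0)
open import Data.Integer.DivMod using (a≡a%n+[a/n]*n; n%d<d)
open import Data.Integer.Tactic.RingSolver using (solve-∀)
open import Data.Rational.Unnormalised.Base using (mkℚᵘ; *≡*; *<*)
open import Data.Product.Base using (_,_)
open import Data.Sum.Base using (inj₁; inj₂)
open import Function.Bundles using (mk⇔)
open import Function.Properties.Equivalence using () renaming (trans to ⇔-trans)
open import Relation.Binary.PropositionalEquality
  using (sym; trans; cong; cong₂; subst; subst₂; module ≡-Reasoning)
import Data.Nat.Properties as ℕP
import Data.Nat.Divisibility as ℕD
import Data.Nat.DivMod as ℕDM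
import Data.Integer.Properties as ℤP
import Data.Integer.Divisibility.Signed as Signed
import Data.Rational.Properties as ℚP
import Data.Rational.Unnormalised.Properties as ℚᵘP

/-cross-≡ : ∀ p r m n → p ℚ./ suc m ≡ r ℚ./ suc n → p * + suc n ≡ r * + suc m
/-cross-≡ p r m n eq with ℚP./-injective-≃ (mkℚᵘ p m) (mkℚᵘ r n) eq
... | *≡* cross = cross

/-cross-< : ∀ p r m n → p ℚ./ suc m ℚ.< r ℚ./ suc n → p * + suc n < r * + suc m
/-cross-< p r m n lt
  with ℚᵘP.<-respʳ-≃ (ℚP.toℚᵘ-fromℚᵘ (mkℚᵘ r n))
         (ℚᵘP.<-respˡ-≃ (ℚP.toℚᵘ-fromℚᵘ (mkℚᵘ p m)) (ℚP.toℚᵘ-mono-< lt))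
... | *<* cross = cross

a*x≡b*y⇒x≡b*gcd[x,y] : ∀ {a b} x y → ℕG.gcd a b ≡ 1 → a ℕ.* x ≡ b ℕ.* y → x ≡ b ℕ.* ℕG.gcd x y
a*x≡b*y⇒x≡b*gcd[x,y] {a} {b} x y coprime ax≡by = begin
  x                           ≡⟨ ℕP.*-identityʳ x ⟨
  x ℕ.* 1                     ≡⟨ cong (x ℕ.*_) (trans (ℕG.gcd-comm b a) coprime) ⟨
  x ℕ.* ℕG.gcd b a            ≡⟨ ℕG.c*gcd[m,n]≡gcd[cm,cn] x b a ⟩
  ℕG.gcd (x ℕ.* b) (x ℕ.* a)  ≡⟨ cong₂ ℕG.gcd (ℕP.*-comm x b) (trans (ℕP.*-comm x a) ax≡by) ⟩
  ℕG.gcd (b ℕ.* x) (b ℕ.* y)  ≡⟨ ℕG.c*gcd[m,n]≡gcd[cm,cn] b x y ⟨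
  b ℕ.* ℕG.gcd x y            ∎
  where open ≡-Reasoning

a*x≡b*y⇒x-y≡[b-a]*gcd[x,y] : ∀ {a b} {x y : ℤ} → 0ℤ ≤ x → 0ℤ ≤ y → ℕG.gcd a b ≡ 1 →
                              + a * x ≡ + b * y → x - y ≡ (+ b - + a) * gcd x y
a*x≡b*y⇒x-y≡[b-a]*gcd[x,y] {a} {b} {+ x} {+ y} (+≤+ _) (+≤+ _) coprime ax≡by = begin
  + x - + y                  ≡⟨ cong₂ (λ s t → + s - + t) x≡bk y≡ak ⟩
  + (b ℕ.* k) - + (a ℕ.* k)  ≡⟨ cong₂ _-_ (ℤP.pos-* b k) (ℤP.pos-* a k) ⟩
  + b * + k - + a * + k      ≡⟨ factor (+ b) (+ a) (+ k) ⟩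
  (+ b - + a) * + k          ∎
  where
  open ≡-Reasoning
  k = ℕG.gcd x y
  factor : ∀ i j l → i * l - j * l ≡ (i - j) * l
  factor = solve-∀
  ax≡by′ : a ℕ.* x ≡ b ℕ.* y
  ax≡by′ = ℤP.+-injective (trans (ℤP.pos-* a x) (trans ax≡by (sym (ℤP.pos-* b y))))
  x≡bk : x ≡ b ℕ.* k
  x≡bk = a*x≡b*y⇒x≡b*gcd[x,y] {a} {b} x y coprime ax≡by′
  y≡ak : y ≡ a ℕ.* k
  y≡ak = trans (a*x≡b*y⇒x≡b*gcd[x,y] {b} {a} y x (trans (ℕG.gcd-comm b a) coprime) (sym ax≡by′))
               (cong (a ℕ.*_) (ℕG.gcd-comm y x))

a*[C*U+D]≡b*[C*V+D] : ∀ a b C U V D → (a * U - b * V) * C ≡ (b - a) * D →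
                      a * (C * U + D) ≡ b * (C * V + D)
a*[C*U+D]≡b*[C*V+D] a b C U V D eq =
  ℤP.i-j≡0⇒i≡j _ _ (trans (expand a b C U V D) (ℤP.i≡j⇒i-j≡0 eq))
  where
  expand : ∀ a b C U V D → a * (C * U + D) - b * (C * V + D) ≡ (a * U - b * V) * C - (b - a) * D
  expand = solve-∀

-D<m*C⇒0<C*t+D : ∀ C D m t → - D < m * + C → m ≤ t → 0ℤ < + C * t + D
-D<m*C⇒0<C*t+D C D m t -D<mC m≤t =
  subst (_< + C * t + D) (ℤP.+-inverseˡ D) (ℤP.+-monoˡ-< D -D<Ct)
  where
  -D<Ct : - D < + C * t
  -D<Ct = ℤP.<-≤-trans -D<mC
            (subst (m * + C ≤_) (ℤP.*-comm t (+ C)) (ℤP.*-monoʳ-≤-nonNeg (+ C) m≤t))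

n∣m*o⇔n∣gcd[m,n]*o : ∀ m n o → n ℕD.∣ m ℕ.* o ⇔ n ℕD.∣ ℕG.gcd m n ℕ.* o
n∣m*o⇔n∣gcd[m,n]*o m n o = mk⇔
  (λ n∣mo → subst (n ℕD.∣_) gcd[mo,no]≡gcd[m,n]*o (ℕG.gcd-greatest n∣mo (ℕD.m∣m*n o)))
  (λ n∣go → ℕD.∣-trans n∣go (ℕD.*-monoˡ-∣ o (ℕG.gcd[m,n]∣m m n)))
  where
  open ≡-Reasoning
  gcd[mo,no]≡gcd[m,n]*o : ℕG.gcd (m ℕ.* o) (n ℕ.* o) ≡ ℕG.gcd m n ℕ.* o
  gcd[mo,no]≡gcd[m,n]*o = begin
    ℕG.gcd (m ℕ.* o) (n ℕ.* o)  ≡⟨ cong₂ ℕG.gcd (ℕP.*-comm m o) (ℕP.*-comm n o) ⟩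
    ℕG.gcd (o ℕ.* m) (o ℕ.* n)  ≡⟨ ℕG.c*gcd[m,n]≡gcd[cm,cn] o m n ⟨
    o ℕ.* ℕG.gcd m n            ≡⟨ ℕP.*-comm o _ ⟩
    ℕG.gcd m n ℕ.* o            ∎

j∣i*k⇔j∣gcd[i,j]*k : ∀ i j k → j ∣ i * k ⇔ j ∣ gcd i j * k
j∣i*k⇔j∣gcd[i,j]*k i j k
  rewrite ℤP.abs-* i k | ℤP.abs-* (gcd i j) k = n∣m*o⇔n∣gcd[m,n]*o ℤ.∣ i ∣ ℤ.∣ j ∣ ℤ.∣ k ∣

[i/j]*j≡i : ∀ {i} j .{{_ : NonZero j}} → j ∣ i → (i / j) * j ≡ i
[i/j]*j≡i {i} j j∣i = begin
  (i / j) * j              ≡⟨ ℤP.+-identityˡ _ ⟨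
  + 0 + (i / j) * j        ≡⟨ cong (λ r → + r + (i / j) * j) i%j≡0 ⟨
  + (i % j) + (i / j) * j  ≡⟨ division ⟨
  i                        ∎
  where
  open ≡-Reasoning
  division : i ≡ + (i % j) + (i / j) * j
  division = a≡a%n+[a/n]*n i j
  j∣i%j : j Signed.∣ + (i % j)
  j∣i%j = Signed.∣m+n∣n⇒∣m (subst (j Signed.∣_) division (Signed.∣ᵤ⇒∣ j∣i))
                           (Signed.∣n⇒∣m*n (i / j) (Signed.∣-refl {j}))
  i%j≡0 : i % j ≡ 0
  i%j≡0 = trans (sym (ℕDM.m<n⇒m%n≡m (n%d<d i j))) (ℕD.n∣m⇒m%n≡0 _ _ (Signed.∣⇒∣ᵤ j∣i%j))

i∣j*k⇔i/j∣k : ∀ {i} j k .{{_ : NonZero j}} → j ∣ i → i ∣ j * k ⇔ (i / j) ∣ k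
i∣j*k⇔i/j∣k {i} j k j∣i = mk⇔
  (λ i∣jk → *-cancelʳ-∣ j {i / j} {k} (subst₂ _∣_ (sym i≡[i/j]*j) (ℤP.*-comm j k) i∣jk))
  (λ i/j∣k → subst₂ _∣_ i≡[i/j]*j (ℤP.*-comm k j) (*-monoˡ-∣ j {i / j} {k} i/j∣k))
  where
  i≡[i/j]*j : (i / j) * j ≡ i
  i≡[i/j]*j = [i/j]*j≡i j j∣i

i*s≡n*k⇒s∣q*k⇔n∣i*q : ∀ {i s n k} q .{{_ : NonZero i}} .{{_ : NonZero k}} →
                      i * s ≡ n * k → s ∣ q * k ⇔ n ∣ i * q
i*s≡n*k⇒s∣q*k⇔n∣i*q {i} {s} {n} {k} q is≡nk = mk⇔
  (λ s∣qk → *-cancelʳ-∣ k {n} {i * q}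
    (subst₂ _∣_ is≡nk (sym (ℤP.*-assoc i q k)) (*-monoʳ-∣ i {s} {q * k} s∣qk)))
  (λ n∣iq → *-cancelˡ-∣ i {s} {q * k}
    (subst₂ _∣_ (sym is≡nk) (ℤP.*-assoc i q k) (*-monoˡ-∣ k {n} {i * q} n∣iq)))

d*c*s≡n*k⇒s∣q*k⇔n∣gcd[d,n]*[c*q] :
  ∀ {d c s n k} q .{{_ : NonZero c}} .{{_ : NonZero k}} .{{_ : NonZero (gcd d n)}} →
  d * c * s ≡ n * k → s ∣ q * k ⇔ n ∣ gcd d n * (c * q)
d*c*s≡n*k⇒s∣q*k⇔n∣gcd[d,n]*[c*q] {d} {c} {s} {n} {k} q dcs≡nk = ⇔-trans
  (subst (λ z → s ∣ q * k ⇔ n ∣ z) (ℤP.*-assoc d c q)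
    (i*s≡n*k⇒s∣q*k⇔n∣i*q {d * c} {s} {n} {k} q dcs≡nk))
  (j∣i*k⇔j∣gcd[i,j]*k d n (c * q))
  where
  d≢0 : d ≢ 0ℤ
  d≢0 d≡0 with ℤP.i*j≡0⇒i≡0∨j≡0 n (trans (sym dcs≡nk) (cong (λ x → x * c * s) d≡0))
  ... | inj₁ n≡0 = ℕ.≢-nonZero⁻¹ ℤ.∣ gcd d n ∣ (cong ℤ.∣_∣ (cong₂ gcd d≡0 n≡0))
  ... | inj₂ k≡0 = ℕ.≢-nonZero⁻¹ ℤ.∣ k ∣ (cong ℤ.∣_∣ k≡0)

  instance
    dc≢0 : NonZero (d * c)
    dc≢0 = ℤP.i*j≢0 d c {{ℤ.≢-nonZero d≢0}}

[u-v]*C*[u+v]≡[b-a]*k : ∀ {a b} C D u v → ℕG.gcd a b ≡ 1 →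
  0ℤ < + C * (u * u) + D → 0ℤ < + C * (v * v) + D →
  (+ a * (u * u) - + b * (v * v)) * + C ≡ (+ b - + a) * D →
  (u - v) * + C * (u + v) ≡ (+ b - + a) * kfun C D u v
[u-v]*C*[u+v]≡[b-a]*k {a} {b} C D u v coprime X>0 Y>0 eq = trans (difference u v (+ C) D)
  (a*x≡b*y⇒x-y≡[b-a]*gcd[x,y] {a} {b} (ℤP.<⇒≤ X>0) (ℤP.<⇒≤ Y>0) coprime
    (a*[C*U+D]≡b*[C*V+D] (+ a) (+ b) (+ C) (u * u) (v * v) D eq))
  where
  difference : ∀ u v C D → (u - v) * C * (u + v) ≡ (C * (u * u) + D) - (C * (v * v) + D)
  difference = solve-∀

proposition8p4 : (C₃ : ℕ) .{{_ : ℕ.NonZero C₃}} (D : ℤ) → D ≢ 0ℤ → gcd (+ C₃) D ≡ 1ℤ →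
    (q : ℕ) .{{_ : ℕ.NonZero q}} →
    (a b : ℕ) → ℕG.gcd a b ≡ 1 →
    (u v : ℤ) → gcd u v ≡ 1ℤ →
    (- D) ℚ./ C₃ ℚ.< ((u * u) ⊓ (v * v)) ℚ./ 1 →
    (+ a * (u * u) - + b * (v * v)) ℚ./ 1 ≡ ((+ b - + a) * D) ℚ./ C₃ →
    .{{_ : NonZero (gfun a b u v)}} →
    ((u + v) ∣ (+ q * kfun C₃ D u v) ⇔ c3fun a b u v ∣ (+ C₃ * + q))
    × ((u + v) ∣ (+ q * kfun C₃ D u v) ⇔ (+ b - + a) ∣ (gfun a b u v * (+ C₃ * + q)))
proposition8p4 C₃@(suc c) D _ _ q a b coprime u v _ min-bound diophantine =
  ⇔-trans criterion c₃-criterion , criterion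
  where
  -D<min*C : - D < ((u * u) ⊓ (v * v)) * + C₃
  -D<min*C = subst (_< _) (ℤP.*-identityʳ (- D))
                   (/-cross-< (- D) ((u * u) ⊓ (v * v)) c 0 min-bound)

  X>0 : 0ℤ < + C₃ * (u * u) + D
  X>0 = -D<m*C⇒0<C*t+D C₃ D _ (u * u) -D<min*C (ℤP.i⊓j≤i (u * u) (v * v))

  Y>0 : 0ℤ < + C₃ * (v * v) + D
  Y>0 = -D<m*C⇒0<C*t+D C₃ D _ (v * v) -D<min*C (ℤP.i⊓j≤j (u * u) (v * v))

  cleared : (+ a * (u * u) - + b * (v * v)) * + C₃ ≡ (+ b - + a) * D
  cleared = trans (/-cross-≡ (+ a * (u * u) - + b * (v * v)) ((+ b - + a) * D) 0 c diophantine)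
                  (ℤP.*-identityʳ _)

  instance
    k≢0 : NonZero (kfun C₃ D u v)
    k≢0 = ℤ.≢-nonZero λ k≡0 →
      ℤP.<⇒≢ X>0 (sym (gcd[i,j]≡0⇒i≡0 (+ C₃ * (u * u) + D) (+ C₃ * (v * v) + D) k≡0))

  criterion : (u + v) ∣ + q * kfun C₃ D u v ⇔ (+ b - + a) ∣ gfun a b u v * (+ C₃ * + q)
  criterion = d*c*s≡n*k⇒s∣q*k⇔n∣gcd[d,n]*[c*q] {u - v} {+ C₃} {u + v} {+ b - + a} (+ q)
    ([u-v]*C*[u+v]≡[b-a]*k {a} {b} C₃ D u v coprime X>0 Y>0 cleared)

  c₃-criterion : (+ b - + a) ∣ gfun a b u v * (+ C₃ * + q) ⇔ c3fun a b u v ∣ + C₃ * + q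
  c₃-criterion = i∣j*k⇔i/j∣k {+ b - + a} (gfun a b u v) (+ C₃ * + q) (gcd[i,j]∣j (u - v) (+ b - + a))
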